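{- Let $P_1\mapsto P_2$ be a rewrite rule, $C$ a context, $\sigma$ an instantiation, and $X$ a term variable, and suppose $P_2\rhd(\Theta;\langle\Phi,\Psi\rangle;\Xi)$ and $\mathrm{core}(C)[X]\rhd(\{X:\langle\phi_X,\psi_X\rangle\};\langle\Phi',\Psi'\rangle;\Xi')$. Suppose $\vdash C[P_1\sigma]:\langle\mathtt P,\emptyset\rangle$ for some set $\mathtt P$ of basic types. Then the rule $P_1\mapsto P_2$ can be applied to $C[P_1\sigma]$ (i.e. there exist a basis $\Delta$ and a type $\langle\mathtt P'',\mathtt R''\rangle$ such that $\sigma$ agrees with $\Delta$, $P_1\mapsto P_2$ is a $\Delta$-$\langle\mathtt P'',\mathtt R''\rangle$-reduction rule, and $\langle\mathtt P'',\mathtt R''\rangle$ is OK for $C$) if and only if the type mapping $\mathsf m$ defined by $\mathsf m(\varphi_x)=t$ and $\mathsf m(\psi_x)=R_t$ if $\sigma(x):t\in\Gamma$, and $\mathsf m(\phi_\eta)=\mathtt P'$, $\mathsf m(\psi_\eta)=\mathtt R'$ if $\vdash\sigma(\eta):\langle\mathtt P',\mathtt R'\rangle$, satisfies the set of constraints $\Xi\cup\Xi'\cup\{\Phi=\phi_X,\ \Psi=\psi_X\}$, together with the constraint $\Psi'=\emptyset$ in case $\phi_X$ or $\psi_X$ occurs in $\Psi'$.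
   Context: CLS syntax. Fix an alphabet $\mathcal{E}$ of element symbols $a,b,\dots$. Sequences $S ::= \epsilon \mid a \mid S\cdot S$; terms $T ::= S \mid (S)^L\rfloor T \mid T\,|\,T$ ($(S)^L\rfloor T$ is a membrane $S$ containing $T$). Structural congruence $\equiv$ is the least congruence such that $\cdot$ is associative with unit $\epsilon$; $|$ is associative and commutative with unit $\epsilon$; $(\epsilon)^L\rfloor\epsilon\equiv\epsilon$; $(S_1\cdot S_2)^L\rfloor T\equiv (S_2\cdot S_1)^L\rfloor T$; congruent sequences are congruent terms and may be exchanged inside loops. Patterns additionally allow term variables $X,\dots$, sequence variables $\tilde x,\dots$ and element variables $x,\dots$: $P ::= SP \mid (SP)^L\rfloor P \mid P\,|\,P \mid X$, $SP ::= \epsilon\mid a\mid SP\cdot SP\mid \tilde x\mid x$. An instantiation $\sigma$ maps term variables to terms, sequence variables to sequences and element variables to elements; $P\sigma$ is the substituted pattern. A rewrite rule $P_1\mapsto P_2$ is a pair of patterns with $P_1\not\equiv\epsilon$ and every variable of $P_2$ occurring in $P_1$. Contexts: $C ::= \square \mid C\,|\,T \mid T\,|\,C \mid (S)^L\rfloor C$; $C[T]$ fills the hole, $C_1[C_2]$ is context composition. Core of a context: $\mathrm{core}(C)=C$ if $C\equiv\square\,|\,T_1$ or $C\equiv (S_1)^L\rfloor(\square\,|\,T_1)\,|\,T_2$; and $\mathrm{core}(C)=C_2$ if $C=C_1[C_2]$ with $C_2\equiv (S_2)^L\rfloor\big((S_1)^L\rfloor(\square\,|\,T_1)\,|\,T_2\big)$.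 Types. Fix an assignment $\Gamma$ of a basic type to each element of $\mathcal{E}$ (written $a:t\in\Gamma$). For each basic type $t$ there are fixed sets $R_t$ and $E_t$ of basic types with $t\notin R_t\cup E_t$, $R_t\cap E_t=\emptyset$. For a set $\mathtt P$ of basic types let $\overline{E}(\mathtt P)=\bigcup_{t\in\mathtt P}E_t$. A type is a pair $\langle\mathtt P,\mathtt R\rangle$ of sets of basic types; it is well formed if $\mathtt P\cap\overline E(\mathtt P)=\mathtt P\cap\mathtt R=\mathtt R\cap\overline E(\mathtt P)=\emptyset$. Well-formed types are compatible, $\langle\mathtt P,\mathtt R\rangle\bowtie\langle\mathtt P',\mathtt R'\rangle$, if $\overline E(\mathtt P)\cap\mathtt P'=\overline E(\mathtt P)\cap\mathtt R'=\overline E(\mathtt P')\cap\mathtt P=\overline E(\mathtt P')\cap\mathtt R=\emptyset$; their conjunction is $\langle\mathtt P\cup\mathtt P',(\mathtt R\cup\mathtt R')\setminus(\mathtt P\cup\mathtt P')\rangle$. A basis $\Delta$ assigns to element variables types $\langle\{t\},R_t\rangle$ and to term/sequence variables types $\langle\mathtt P,\mathtt R\rangle$. Typing rules for $\Delta\vdash P:\langle\mathtt P,\mathtt R\rangle$: $\Delta,\rho:\langle\mathtt P,\mathtt R\rangle\vdash\rho:\langle\mathtt P,\mathtt R\rangle$; $\Delta\vdash\epsilon:\langle\emptyset,\emptyset\rangle$; if $a:t\in\Gamma$ then $\Delta\vdash a:\langle\{t\},R_t\rangle$; if $\Delta\vdash SP:\tau$, $\Delta\vdash SP':\tau'$ and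 $\tau\bowtie\tau'$ then $SP\cdot SP'$ gets the conjunction of $\tau,\tau'$; likewise for $P\,|\,P'$; if $\Delta\vdash SP:\langle\mathtt P,\mathtt R\rangle$, $\Delta\vdash P:\langle\mathtt P',\mathtt R'\rangle$, these are compatible and $\mathtt R'\subseteq\mathtt P$, then $\Delta\vdash (SP)^L\rfloor P:\langle\mathtt P,\mathtt R\setminus\mathtt P'\rangle$. $\vdash$ alone means the empty basis. A well-formed type $\langle\mathtt P,\mathtt R\rangle$ is OK for a context $C$ if $X:\langle\mathtt P,\mathtt R\rangle\vdash C[X]:\langle\mathtt P',\emptyset\rangle$ for some $\mathtt P'$. A rule $P_1\mapsto P_2$ is a $\Delta$-$\langle\mathtt P,\mathtt R\rangle$-reduction rule if $\Delta\vdash P_2:\langle\mathtt P,\mathtt R\rangle$. An instantiation $\sigma$ agrees with $\Delta$ if $\rho:\langle\mathtt P,\mathtt R\rangle\in\Delta$ implies $\vdash\sigma(\rho):\langle\mathtt P,\mathtt R\rangle$. Type inference. To each element variable $x$ associate an e-type variable $\varphi_x$ (ranging over basic types) and an r-type variable $\psi_x$; to each term or sequence variable $\eta$ a p-type variable $\phi_\eta$ and an r-type variable $\psi_\eta$ (ranging over sets of basic types). $\Phi,\Psi$ are formal set expressions built with $\cup,\setminus$ from finite sets of basic types, singletons $\{\varphi_x\}$, type variables and $R_{\varphi_x}$. Constraints are formal equalities, inclusions and compatibilities $\langle\Phi,\Psi\rangle\bowtie\langle\Phi',\Psi'\rangle$. The judgement $P\rhd(\Theta;\langle\Phi,\Psi\rangle;\Xi)$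 is derived by: $\epsilon\rhd(\emptyset;\langle\emptyset,\emptyset\rangle;\emptyset)$; if $a:t\in\Gamma$ then $a\rhd(\emptyset;\langle\{t\},R_t\rangle;\emptyset)$; $x\rhd(\{x:\langle\varphi_x,\psi_x\rangle\};\langle\{\varphi_x\},\psi_x\rangle;\{\psi_x=R_{\varphi_x}\})$; $\eta\rhd(\{\eta:\langle\phi_\eta,\psi_\eta\rangle\};\langle\phi_\eta,\psi_\eta\rangle;\emptyset)$; if $A\rhd(\Theta;\langle\Phi,\Psi\rangle;\Xi)$ and $B\rhd(\Theta';\langle\Phi',\Psi'\rangle;\Xi')$, with $A\circ B$ being $SP\cdot SP'$ or $P\,|\,P'$, then $A\circ B\rhd(\Theta\cup\Theta';\langle\Phi\cup\Phi',(\Psi\cup\Psi')\setminus(\Phi\cup\Phi')\rangle;\Xi\cup\Xi'\cup\{\langle\Phi,\Psi\rangle\bowtie\langle\Phi',\Psi'\rangle\})$; if $SP\rhd(\Theta;\langle\Phi,\Psi\rangle;\Xi)$ and $P\rhd(\Theta';\langle\Phi',\Psi'\rangle;\Xi')$ then $(SP)^L\rfloor P\rhd(\Theta\cup\Theta';\langle\Phi,\Psi\setminus\Phi'\rangle;\Xi\cup\Xi'\cup\{\langle\Phi,\Psi\rangle\bowtie\langle\Phi',\Psi'\rangle,\ \Psi'\subseteq\Phi\})$. A type mapping $\mathsf m$ assigns basic types to e-type variables and sets of basic types to p-/r-type variables, extended to expressions by substitution ($R_{\varphi_x}\mapsto R_{\mathsf m(\varphi_x)}$) and evaluation; $\mathsf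 m$ satisfies a constraint set if every constraint holds after applying $\mathsf m$ (set equality/inclusion; $\bowtie$ meaning both types are well formed and compatible). -}

module Defs where

open import Data.Nat using (ℕ)
open import Data.Fin using (Fin)
open import Data.Fin.Subset using (Subset; ⊥; ⁅_⁆; _∪_; _∩_; _─_; _⊆_; _∈_; _∉_; ⋃)
open import Data.Bool using (if_then_else_)
open import Data.Vec using (lookup)
open import Data.List using (List; []; _∷_; _++_; [_]; allFin)
import Data.List as L
open import Data.List.Membership.Propositional using () renaming (_∈_ to _∈ₗ_; _∉_ to _∉ₗ_)
open import Data.List.Relation.Unary.All using (All)
open import Data.Maybe using (Maybe; just; nothing)
open import Data.Product using (Σ; ∃; _×_; _,_)
open import Relation.Binary.PropositionalEquality using (_≡_)
open import Relation.Nullary using (¬_)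

-- The whole development is parametric in
--   n   : the number of basic types (basic types are Fin n),
--   E   : the alphabet of element symbols,
--   Γ   : the assignment of a basic type to each element,
--   R Ex: the sets R_t and E_t (their side conditions are hypotheses
--         of the theorem).

module CLS {n : ℕ} {E : Set} (Γ : E → Fin n) (R Ex : Fin n → Subset n) where

  BSet : Set
  BSet = Subset n

  infixr 8 _·_ _·ₚ_
  infixr 6 _∣_ _∣ₚ_

  data Seq : Set where
    ε   : Seq
    el  : E → Seq
    _·_ : Seq → Seq → Seq

  data Term : Set where
    sq  : Seq → Term
    mem : Seq → Term → Term
    _∣_ : Term → Term → Term

  data SPat : Set where
    εₚ   : SPat
    elₚ  : E → SPat
    _·ₚ_ : SPat → SPat → SPat
    svar : ℕ → SPat
    evar : ℕ → SPat

  data Pat : Set where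
    sqₚ  : SPat → Pat
    memₚ : SPat → Pat → Pat
    _∣ₚ_ : Pat → Pat → Pat
    tvar : ℕ → Pat

  data Ctx : Set where
    □    : Ctx
    _∣ˡ_ : Ctx → Term → Ctx
    _∣ʳ_ : Term → Ctx → Ctx
    memC : Seq → Ctx → Ctx

  ⌜_⌝ˢ : Seq → SPat
  ⌜ ε ⌝ˢ = εₚ
  ⌜ el a ⌝ˢ = elₚ a
  ⌜ s · s' ⌝ˢ = ⌜ s ⌝ˢ ·ₚ ⌜ s' ⌝ˢ

  ⌜_⌝ : Term → Pat
  ⌜ sq s ⌝ = sqₚ ⌜ s ⌝ˢ
  ⌜ mem s t ⌝ = memₚ ⌜ s ⌝ˢ ⌜ t ⌝
  ⌜ t ∣ t' ⌝ = ⌜ t ⌝ ∣ₚ ⌜ t' ⌝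

  fill : Ctx → Term → Term
  fill □ t = t
  fill (c ∣ˡ u) t = fill c t ∣ u
  fill (u ∣ʳ c) t = u ∣ fill c t
  fill (memC s c) t = mem s (fill c t)

  fillₚ : Ctx → Pat → Pat
  fillₚ □ p = p
  fillₚ (c ∣ˡ u) p = fillₚ c p ∣ₚ ⌜ u ⌝
  fillₚ (u ∣ʳ c) p = ⌜ u ⌝ ∣ₚ fillₚ c p
  fillₚ (memC s c) p = memₚ ⌜ s ⌝ˢ (fillₚ c p)

  _∘ᶜ_ : Ctx → Ctx → Ctx
  □ ∘ᶜ c₂ = c₂
  (c ∣ˡ u) ∘ᶜ c₂ = (c ∘ᶜ c₂) ∣ˡ u
  (u ∣ʳ c) ∘ᶜ c₂ = u ∣ʳ (c ∘ᶜ c₂)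
  memC s c ∘ᶜ c₂ = memC s (c ∘ᶜ c₂)

  infix 4 _≅ˢ_ _≅_

  data _≅ˢ_ : SPat → SPat → Set where
    ≅ˢ-refl  : ∀ {s} → s ≅ˢ s
    ≅ˢ-sym   : ∀ {s s'} → s ≅ˢ s' → s' ≅ˢ s
    ≅ˢ-trans : ∀ {s s' s''} → s ≅ˢ s' → s' ≅ˢ s'' → s ≅ˢ s''
    ≅ˢ-cong  : ∀ {s₁ s₁' s₂ s₂'} → s₁ ≅ˢ s₁' → s₂ ≅ˢ s₂' → s₁ ·ₚ s₂ ≅ˢ s₁' ·ₚ s₂'
    ≅ˢ-assoc : ∀ {s₁ s₂ s₃} → (s₁ ·ₚ s₂) ·ₚ s₃ ≅ˢ s₁ ·ₚ (s₂ ·ₚ s₃)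
    ≅ˢ-unitˡ : ∀ {s} → εₚ ·ₚ s ≅ˢ s
    ≅ˢ-unitʳ : ∀ {s} → s ·ₚ εₚ ≅ˢ s

  data _≅_ : Pat → Pat → Set where
    ≅-refl     : ∀ {p} → p ≅ p
    ≅-sym      : ∀ {p p'} → p ≅ p' → p' ≅ p
    ≅-trans    : ∀ {p p' p''} → p ≅ p' → p' ≅ p'' → p ≅ p''
    ≅-seq      : ∀ {s s'} → s ≅ˢ s' → sqₚ s ≅ sqₚ s'
    ≅-mem      : ∀ {s s' p p'} → s ≅ˢ s' → p ≅ p' → memₚ s p ≅ memₚ s' p'
    ≅-par      : ∀ {p₁ p₁' p₂ p₂'} → p₁ ≅ p₁' → p₂ ≅ p₂' → p₁ ∣ₚ p₂ ≅ p₁' ∣ₚ p₂'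
    ≅-assoc    : ∀ {p₁ p₂ p₃} → (p₁ ∣ₚ p₂) ∣ₚ p₃ ≅ p₁ ∣ₚ (p₂ ∣ₚ p₃)
    ≅-comm     : ∀ {p₁ p₂} → p₁ ∣ₚ p₂ ≅ p₂ ∣ₚ p₁
    ≅-unit     : ∀ {p} → p ∣ₚ sqₚ εₚ ≅ p
    ≅-memε     : memₚ εₚ (sqₚ εₚ) ≅ sqₚ εₚ
    ≅-rot      : ∀ {s₁ s₂ p} → memₚ (s₁ ·ₚ s₂) p ≅ memₚ (s₂ ·ₚ s₁) p

  -- congruence of contexts: compare them with the hole replaced by a
  -- (fixed) term variable; contexts contain no variables themselves.
  _≅ᶜ_ : Ctx → Ctx → Set
  c ≅ᶜ c' = fillₚ c (tvar 0) ≅ fillₚ c' (tvar 0)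

  -- core(C), as a relation "C₀ is a core of C"
  data IsCore (c : Ctx) : Ctx → Set where
    core₁ : ∀ {T₁} → c ≅ᶜ (□ ∣ˡ T₁) → IsCore c c
    core₂ : ∀ {S₁ T₁ T₂} → c ≅ᶜ (memC S₁ (□ ∣ˡ T₁) ∣ˡ T₂) → IsCore c c
    core₃ : ∀ {c₁ c₂ S₁ S₂ T₁ T₂} → c ≡ c₁ ∘ᶜ c₂ →
            c₂ ≅ᶜ memC S₂ (memC S₁ (□ ∣ˡ T₁) ∣ˡ T₂) → IsCore c c₂

  data Var : Set where
    tv : ℕ → Var
    sv : ℕ → Var
    ev : ℕ → Var

  varsˢ : SPat → List Var
  varsˢ εₚ = []
  varsˢ (elₚ a) = []
  varsˢ (s ·ₚ s') = varsˢ s ++ varsˢ s'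
  varsˢ (svar x) = [ sv x ]
  varsˢ (evar x) = [ ev x ]

  vars : Pat → List Var
  vars (sqₚ s) = varsˢ s
  vars (memₚ s p) = varsˢ s ++ vars p
  vars (p ∣ₚ p') = vars p ++ vars p'
  vars (tvar x) = [ tv x ]

  record Inst : Set where
    field
      tσ : ℕ → Term
      sσ : ℕ → Seq
      eσ : ℕ → E
  open Inst public

  instˢ : Inst → SPat → Seq
  instˢ σ εₚ = ε
  instˢ σ (elₚ a) = el a
  instˢ σ (s ·ₚ s') = instˢ σ s · instˢ σ s'
  instˢ σ (svar x) = sσ σ x
  instˢ σ (evar x) = el (eσ σ x)

  inst : Inst → Pat → Term
  inst σ (sqₚ s) = sq (instˢ σ s)
  inst σ (memₚ s p) = mem (instˢ σ s) (inst σ p)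
  inst σ (p ∣ₚ p') = inst σ p ∣ inst σ p'
  inst σ (tvar x) = tσ σ x

  RewriteRule : Pat → Pat → Set
  RewriteRule P₁ P₂ = ¬ (P₁ ≅ sqₚ εₚ) × (∀ {v} → v ∈ₗ vars P₂ → v ∈ₗ vars P₁)

  Ty : Set
  Ty = BSet × BSet

  -- Ē(P) = ⋃_{t ∈ P} E_t
  Ē : BSet → BSet
  Ē P = ⋃ (L.map (λ t → if lookup P t then Ex t else ⊥) (allFin n))

  WF : Ty → Set
  WF (P , Rr) = P ∩ Ē P ≡ ⊥ × P ∩ Rr ≡ ⊥ × Rr ∩ Ē P ≡ ⊥

  _⋈_ : Ty → Ty → Set
  (P , Rr) ⋈ (P' , Rr') = WF (P , Rr) × WF (P' , Rr') ×
    Ē P ∩ P' ≡ ⊥ × Ē P ∩ Rr' ≡ ⊥ × Ē P' ∩ P ≡ ⊥ × Ē P' ∩ Rr ≡ ⊥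

  conj : Ty → Ty → Ty
  conj (P , Rr) (P' , Rr') = (P ∪ P') , ((Rr ∪ Rr') ─ (P ∪ P'))

  record Basis : Set where
    field
      typeOf : Var → Maybe Ty
      evShape : ∀ x τ → typeOf (ev x) ≡ just τ → ∃ λ t → τ ≡ (⁅ t ⁆ , R t)
  open Basis public

  emptyBasis : Basis
  emptyBasis = record { typeOf = λ _ → nothing ; evShape = λ _ _ () }

  infix 3 _⊢ˢ_∶_ _⊢_∶_

  data _⊢ˢ_∶_ (Δ : Basis) : SPat → Ty → Set where
    t-svar : ∀ {x τ} → typeOf Δ (sv x) ≡ just τ → Δ ⊢ˢ svar x ∶ τ
    t-evar : ∀ {x τ} → typeOf Δ (ev x) ≡ just τ → Δ ⊢ˢ evar x ∶ τ
    t-ε    : Δ ⊢ˢ εₚ ∶ (⊥ , ⊥)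
    t-el   : ∀ {a} → Δ ⊢ˢ elₚ a ∶ (⁅ Γ a ⁆ , R (Γ a))
    t-·    : ∀ {s s' τ τ'} → Δ ⊢ˢ s ∶ τ → Δ ⊢ˢ s' ∶ τ' → τ ⋈ τ' →
             Δ ⊢ˢ s ·ₚ s' ∶ conj τ τ'

  data _⊢_∶_ (Δ : Basis) : Pat → Ty → Set where
    t-tvar : ∀ {x τ} → typeOf Δ (tv x) ≡ just τ → Δ ⊢ tvar x ∶ τ
    t-seq  : ∀ {s τ} → Δ ⊢ˢ s ∶ τ → Δ ⊢ sqₚ s ∶ τ
    t-∣    : ∀ {p p' τ τ'} → Δ ⊢ p ∶ τ → Δ ⊢ p' ∶ τ' → τ ⋈ τ' →
             Δ ⊢ p ∣ₚ p' ∶ conj τ τ'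
    t-mem  : ∀ {s p P Rr P' Rr'} → Δ ⊢ˢ s ∶ (P , Rr) → Δ ⊢ p ∶ (P' , Rr') →
             (P , Rr) ⋈ (P' , Rr') → Rr' ⊆ P →
             Δ ⊢ memₚ s p ∶ (P , Rr ─ P')

  ⊢ˢ₀_∶_ : Seq → Ty → Set
  ⊢ˢ₀ s ∶ τ = emptyBasis ⊢ˢ ⌜ s ⌝ˢ ∶ τ

  ⊢₀_∶_ : Term → Ty → Set
  ⊢₀ t ∶ τ = emptyBasis ⊢ ⌜ t ⌝ ∶ τ

  single : ℕ → Ty → Basis
  single X τ = record { typeOf = f ; evShape = λ _ _ () }
    where
    f : Var → Maybe Ty
    f (tv y) with y Data.Nat.≟ X
    ... | Relation.Nullary.yes _ = just τ
    ... | Relation.Nullary.no _ = nothing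
    f (sv _) = nothing
    f (ev _) = nothing

  OK : Ty → Ctx → Set
  OK τ C = WF τ × ∃ λ P' → single 0 τ ⊢ fillₚ C (tvar 0) ∶ (P' , ⊥)

  Agrees : Inst → Basis → Set
  Agrees σ Δ = ∀ v τ → typeOf Δ v ≡ just τ → Typed v τ
    where
    Typed : Var → Ty → Set
    Typed (tv x) τ = ⊢₀ tσ σ x ∶ τ
    Typed (sv x) τ = ⊢ˢ₀ sσ σ x ∶ τ
    Typed (ev x) τ = ⊢ˢ₀ el (eσ σ x) ∶ τ

  Applicable : Pat → Pat → Ctx → Inst → Set
  Applicable P₁ P₂ C σ = Σ Basis λ Δ → Σ Ty λ τ →
    Agrees σ Δ × (Δ ⊢ P₂ ∶ τ) × OK τ C

  data SExp : Set where
    lit  : BSet → SExp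
    sing : ℕ → SExp              -- {φ_x}  (x element variable)
    pv   : Var → SExp            -- φ_η    (η term / sequence variable)
    rv   : Var → SExp            -- ψ_x, ψ_η
    Rof  : ℕ → SExp              -- R_{φ_x}
    _∪ₑ_ : SExp → SExp → SExp
    _∖ₑ_ : SExp → SExp → SExp

  data Constraint : Set where
    _≐_  : SExp → SExp → Constraint
    _⊑_  : SExp → SExp → Constraint
    ⋈c   : SExp → SExp → SExp → SExp → Constraint   -- ⟨Φ,Ψ⟩ ⋈ ⟨Φ',Ψ'⟩

  Judg : Set
  Judg = List Var × SExp × SExp × List Constraint   -- (Θ ; ⟨Φ,Ψ⟩ ; Ξ)

  infix 3 _⊳ˢ_ _⊳_

  data _⊳ˢ_ : SPat → Judg → Set where
    i-ε    : εₚ ⊳ˢ ([] , lit ⊥ , lit ⊥ , [])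
    i-el   : ∀ {a} → elₚ a ⊳ˢ ([] , lit ⁅ Γ a ⁆ , lit (R (Γ a)) , [])
    i-evar : ∀ {x} → evar x ⊳ˢ ([ ev x ] , sing x , rv (ev x) , [ rv (ev x) ≐ Rof x ])
    i-svar : ∀ {x} → svar x ⊳ˢ ([ sv x ] , pv (sv x) , rv (sv x) , [])
    i-·    : ∀ {s s' Θ Θ' Φ Φ' Ψ Ψ' Ξ Ξ'} →
             s ⊳ˢ (Θ , Φ , Ψ , Ξ) → s' ⊳ˢ (Θ' , Φ' , Ψ' , Ξ') →
             s ·ₚ s' ⊳ˢ (Θ ++ Θ' , Φ ∪ₑ Φ' , (Ψ ∪ₑ Ψ') ∖ₑ (Φ ∪ₑ Φ') ,
                         Ξ ++ Ξ' ++ [ ⋈c Φ Ψ Φ' Ψ' ])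

  data _⊳_ : Pat → Judg → Set where
    i-seq  : ∀ {s J} → s ⊳ˢ J → sqₚ s ⊳ J
    i-tvar : ∀ {x} → tvar x ⊳ ([ tv x ] , pv (tv x) , rv (tv x) , [])
    i-∣    : ∀ {p p' Θ Θ' Φ Φ' Ψ Ψ' Ξ Ξ'} →
             p ⊳ (Θ , Φ , Ψ , Ξ) → p' ⊳ (Θ' , Φ' , Ψ' , Ξ') →
             p ∣ₚ p' ⊳ (Θ ++ Θ' , Φ ∪ₑ Φ' , (Ψ ∪ₑ Ψ') ∖ₑ (Φ ∪ₑ Φ') ,
                        Ξ ++ Ξ' ++ [ ⋈c Φ Ψ Φ' Ψ' ])
    i-mem  : ∀ {s p Θ Θ' Φ Φ' Ψ Ψ' Ξ Ξ'} →
             s ⊳ˢ (Θ , Φ , Ψ , Ξ) → p ⊳ (Θ' , Φ' , Ψ' , Ξ') →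
             memₚ s p ⊳ (Θ ++ Θ' , Φ , Ψ ∖ₑ Φ' ,
                         Ξ ++ Ξ' ++ (⋈c Φ Ψ Φ' Ψ' ∷ (Ψ' ⊑ Φ) ∷ []))

  record TyMap : Set where
    field
      eM : ℕ → Fin n        -- φ_x  (e-type variables)
      pM : Var → BSet       -- φ_η  (p-type variables)
      rM : Var → BSet       -- ψ_x, ψ_η (r-type variables)
  open TyMap public

  ⟦_⟧_ : SExp → TyMap → BSet
  ⟦ lit s ⟧ m = s
  ⟦ sing x ⟧ m = ⁅ eM m x ⁆
  ⟦ pv v ⟧ m = pM m v
  ⟦ rv v ⟧ m = rM m v
  ⟦ Rof x ⟧ m = R (eM m x)
  ⟦ e ∪ₑ e' ⟧ m = ⟦ e ⟧ m ∪ ⟦ e' ⟧ m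
  ⟦ e ∖ₑ e' ⟧ m = ⟦ e ⟧ m ─ ⟦ e' ⟧ m

  _⊨_ : TyMap → Constraint → Set
  m ⊨ (e ≐ e') = ⟦ e ⟧ m ≡ ⟦ e' ⟧ m
  m ⊨ (e ⊑ e') = ⟦ e ⟧ m ⊆ ⟦ e' ⟧ m
  m ⊨ ⋈c a b c d = (⟦ a ⟧ m , ⟦ b ⟧ m) ⋈ (⟦ c ⟧ m , ⟦ d ⟧ m)

  _⊨*_ : TyMap → List Constraint → Set
  m ⊨* Ξ = All (m ⊨_) Ξ

  -- m is the type mapping determined by σ on the variable v
  -- (for term/sequence variables this includes typability of σ(v))
  MatchesVar : TyMap → Inst → Var → Set
  MatchesVar m σ (ev x) = eM m x ≡ Γ (eσ σ x) × rM m (ev x) ≡ R (Γ (eσ σ x))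
  MatchesVar m σ (sv x) = ⊢ˢ₀ sσ σ x ∶ (pM m (sv x) , rM m (sv x))
  MatchesVar m σ (tv x) = ⊢₀ tσ σ x ∶ (pM m (tv x) , rM m (tv x))

  Matches : TyMap → Inst → List Var → Set
  Matches m σ Θ = ∀ {v} → v ∈ₗ Θ → MatchesVar m σ v

  data OccX (X : ℕ) : SExp → Set where
    occ-p : OccX X (pv (tv X))
    occ-r : OccX X (rv (tv X))
    occ-∪ˡ : ∀ {e e'} → OccX X e → OccX X (e ∪ₑ e')
    occ-∪ʳ : ∀ {e e'} → OccX X e' → OccX X (e ∪ₑ e')
    occ-∖ˡ : ∀ {e e'} → OccX X e → OccX X (e ∖ₑ e')
    occ-∖ʳ : ∀ {e e'} → OccX X e' → OccX X (e ∖ₑ e')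

module Submission where

-- Two correspondences do all the work.
--  * Inference is sound and complete: whenever a basis Δ "represents" a type
--    mapping m on the variables Θ of a pattern p with p ⊳ (Θ;⟨Φ,Ψ⟩;Ξ), then
--    Δ ⊢ p : τ holds iff m satisfies Ξ and τ = ⟨m(Φ),m(Ψ)⟩.
--  * Typing a filled context splits into typing the filling and a judgement
--    C ⊢ᶜ τ ⇒ ρ for the context alone ("a hole of type τ makes C of type ρ").
-- Applied to P₂ this turns "Δ ⊢ P₂ : τ" into Ξ plus Φ = φ_X, Ψ = ψ_X; applied
-- to core(C)[X] it turns "τ is OK for C" into Ξ' plus the side condition on
-- Ψ'.  When the hole of the core lies two membranes deep, φ_X and ψ_X do not
-- occur in Φ',Ψ', so the type of the core does not depend on τ and is fixed
-- by the hypothesis that C[P₁σ] is typable; when the core is all of C, Ψ' must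
-- evaluate to ∅, which is automatic when ψ_X,φ_X do not occur in it.

open import Defs
open import Data.Nat using (ℕ; suc) renaming (_≟_ to _≟ℕ_)
open import Data.Fin using (Fin)
open import Data.Fin.Subset using (Subset; ⊥; ⁅_⁆; _∪_; _∩_; _─_; _⊆_; _∈_; _∉_; ⋃; inside; outside)
open import Data.Fin.Subset.Properties
  using (Empty-unique; ∉⊥; x∈⁅y⁆⇒x≡y; x∈p∩q⁺; x∈p∩q⁻; x∈p∪q⁺; x∈p∪q⁻; p─q⊆p)
open import Data.Bool using (true; false; if_then_else_)
open import Data.Vec using (lookup; _∷_; here; there)
open import Data.Vec.Properties using ([]=⇒lookup; lookup⇒[]=)
open import Data.List using (List; []; _∷_; _++_; [_]; allFin)
import Data.List as L
open import Data.List.Relation.Unary.Any using (Any; here; there; satisfied)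
open import Data.List.Relation.Unary.Any.Properties using (map⁺; map⁻)
open import Data.List.Relation.Unary.All using (All; []; _∷_)
open import Data.List.Relation.Unary.All.Properties using (++⁺; ++⁻)
open import Data.List.Membership.Propositional using (lose) renaming (_∈_ to _∈ₗ_; _∉_ to _∉ₗ_)
open import Data.List.Membership.Propositional.Properties using (∈-allFin; ∈-++⁺ˡ; ∈-++⁺ʳ; ∈-++⁻)
import Data.List.Membership.DecPropositional as DecMembership
open import Data.Maybe using (Maybe; just; nothing; fromMaybe)
open import Data.Maybe.Properties using (just-injective)
open import Data.Empty renaming (⊥ to ⊥₀)
open import Data.Sum using (_⊎_; inj₁; inj₂; [_,_]′)
open import Data.Product using (Σ; ∃; _×_; _,_; proj₁; proj₂)
open import Function using (_∘_; id)
open import Function.Bundles using (_⇔_; mk⇔)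
open import Relation.Binary.PropositionalEquality hiding ([_])
open import Relation.Nullary using (¬_; Dec; yes; no)
open import Relation.Nullary.Decidable using (map′)

private variable n : ℕ

x∈p─q⇒x∉q : ∀ (p q : Subset n) {x} → x ∈ p ─ q → x ∉ q
x∈p─q⇒x∉q (_ ∷ p) (outside ∷ q) here ()
x∈p─q⇒x∉q (_ ∷ p) (inside ∷ q) (there x∈) (there x∈q) = x∈p─q⇒x∉q p q x∈ x∈q
x∈p─q⇒x∉q (_ ∷ p) (outside ∷ q) (there x∈) (there x∈q) = x∈p─q⇒x∉q p q x∈ x∈q

∩≡⊥⁺ : {p q : Subset n} → (∀ {x} → x ∈ p → x ∈ q → ⊥₀) → p ∩ q ≡ ⊥
∩≡⊥⁺ {p = p} {q = q} disj = Empty-unique λ { (x , x∈) → let (x∈p , x∈q) = x∈p∩q⁻ p q x∈ in disj x∈p x∈q }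

∩≡⊥⁻ : {p q : Subset n} → p ∩ q ≡ ⊥ → ∀ {x} → x ∈ p → x ∈ q → ⊥₀
∩≡⊥⁻ {p = p} {q = q} p∩q≡⊥ {x} x∈p x∈q = ∉⊥ (subst (x ∈_) p∩q≡⊥ (x∈p∩q⁺ (x∈p , x∈q)))

x∈⋃⁻ : ∀ (ps : List (Subset n)) {x} → x ∈ ⋃ ps → Any (x ∈_) ps
x∈⋃⁻ [] x∈ = ⊥-elim (∉⊥ x∈)
x∈⋃⁻ (p ∷ ps) x∈ with x∈p∪q⁻ p (⋃ ps) x∈
... | inj₁ x∈p = here x∈p
... | inj₂ x∈ps = there (x∈⋃⁻ ps x∈ps)

x∈⋃⁺ : ∀ (ps : List (Subset n)) {x} → Any (x ∈_) ps → x ∈ ⋃ ps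
x∈⋃⁺ (p ∷ ps) (here x∈p) = x∈p∪q⁺ (inj₁ x∈p)
x∈⋃⁺ (p ∷ ps) (there x∈ps) = x∈p∪q⁺ (inj₂ (x∈⋃⁺ ps x∈ps))

module Theory {n : ℕ} {E : Set} (Γ : E → Fin n) (R Ex : Fin n → Subset n) where
  open CLS Γ R Ex

  guardedEx : BSet → Fin n → BSet
  guardedEx P t = if lookup P t then Ex t else ⊥

  x∈Ē⁻ : ∀ P {x} → x ∈ Ē P → ∃ λ t → t ∈ P × x ∈ Ex t
  x∈Ē⁻ P x∈ with satisfied (map⁻ (x∈⋃⁻ (L.map (guardedEx P) (allFin n)) x∈))
  ... | t , x∈guarded with lookup P t in t∈P
  ... | true = t , lookup⇒[]= t P t∈P , x∈guarded
  ... | false = ⊥-elim (∉⊥ x∈guarded)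

  x∈Ē⁺ : ∀ P {t x} → t ∈ P → x ∈ Ex t → x ∈ Ē P
  x∈Ē⁺ P {t} t∈P x∈Ext =
    x∈⋃⁺ (L.map (guardedEx P) (allFin n)) (map⁺ (lose (∈-allFin t) x∈guarded))
    where
    x∈guarded : _ ∈ guardedEx P t
    x∈guarded rewrite []=⇒lookup t∈P = x∈Ext

  Ē-∪⁻ : ∀ P P' {x} → x ∈ Ē (P ∪ P') → x ∈ Ē P ⊎ x ∈ Ē P'
  Ē-∪⁻ P P' x∈ with x∈Ē⁻ (P ∪ P') x∈
  ... | t , t∈ , x∈Ext with x∈p∪q⁻ P P' t∈
  ... | inj₁ t∈P = inj₁ (x∈Ē⁺ P t∈P x∈Ext)
  ... | inj₂ t∈P' = inj₂ (x∈Ē⁺ P' t∈P' x∈Ext)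

  wf-empty : WF (⊥ , ⊥)
  wf-empty = ∩≡⊥⁺ (λ x∈⊥ _ → ∉⊥ x∈⊥) , ∩≡⊥⁺ (λ x∈⊥ _ → ∉⊥ x∈⊥) , ∩≡⊥⁺ (λ x∈⊥ _ → ∉⊥ x∈⊥)

  wf-conj : ∀ {τ τ'} → τ ⋈ τ' → WF (conj τ τ')
  wf-conj {P , Rr} {P' , Rr'} ((P∩ĒP , _ , Rr∩ĒP) , (P'∩ĒP' , _ , Rr'∩ĒP') , ĒP∩P' , ĒP∩Rr' , ĒP'∩P , ĒP'∩Rr) =
    ∩≡⊥⁺ noP∩Ē , ∩≡⊥⁺ (λ x∈P∪P' x∈Rr─ → x∈p─q⇒x∉q (Rr ∪ Rr') (P ∪ P') x∈Rr─ x∈P∪P') , ∩≡⊥⁺ noRr∩Ē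
    where
    noP∩Ē : ∀ {x} → x ∈ P ∪ P' → x ∈ Ē (P ∪ P') → ⊥₀
    noP∩Ē x∈P x∈Ē with x∈p∪q⁻ P P' x∈P | Ē-∪⁻ P P' x∈Ē
    ... | inj₁ u | inj₁ v = ∩≡⊥⁻ P∩ĒP u v
    ... | inj₁ u | inj₂ v = ∩≡⊥⁻ ĒP'∩P v u
    ... | inj₂ u | inj₁ v = ∩≡⊥⁻ ĒP∩P' v u
    ... | inj₂ u | inj₂ v = ∩≡⊥⁻ P'∩ĒP' u v
    noRr∩Ē : ∀ {x} → x ∈ (Rr ∪ Rr') ─ (P ∪ P') → x ∈ Ē (P ∪ P') → ⊥₀
    noRr∩Ē x∈Rr x∈Ē with x∈p∪q⁻ Rr Rr' (p─q⊆p (Rr ∪ Rr') (P ∪ P') x∈Rr) | Ē-∪⁻ P P' x∈Ē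
    ... | inj₁ u | inj₁ v = ∩≡⊥⁻ Rr∩ĒP u v
    ... | inj₁ u | inj₂ v = ∩≡⊥⁻ ĒP'∩Rr v u
    ... | inj₂ u | inj₁ v = ∩≡⊥⁻ ĒP∩Rr' v u
    ... | inj₂ u | inj₂ v = ∩≡⊥⁻ Rr'∩ĒP' u v

  wf-membrane : ∀ {P Rr} P' → WF (P , Rr) → WF (P , Rr ─ P')
  wf-membrane {P} {Rr} P' (P∩ĒP , P∩Rr , Rr∩ĒP) =
    P∩ĒP ,
    ∩≡⊥⁺ (λ x∈P x∈Rr─ → ∩≡⊥⁻ P∩Rr x∈P (p─q⊆p Rr P' x∈Rr─)) ,
    ∩≡⊥⁺ (λ x∈Rr─ x∈Ē → ∩≡⊥⁻ Rr∩ĒP (p─q⊆p Rr P' x∈Rr─) x∈Ē)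

  elementTypesWF : (∀ t → t ∉ R t) → (∀ t → t ∉ Ex t) → (∀ t → R t ∩ Ex t ≡ ⊥) →
                   ∀ t → WF (⁅ t ⁆ , R t)
  elementTypesWF R-irrefl Ex-irrefl R∩Ex≡⊥ t = ∩≡⊥⁺ noP∩Ē , ∩≡⊥⁺ noP∩R , ∩≡⊥⁺ noR∩Ē
    where
    noP∩Ē : ∀ {x} → x ∈ ⁅ t ⁆ → x ∈ Ē ⁅ t ⁆ → ⊥₀
    noP∩Ē x∈t x∈Ē with x∈Ē⁻ ⁅ t ⁆ x∈Ē
    ... | t' , t'∈t , x∈Ext' with x∈⁅y⁆⇒x≡y t x∈t | x∈⁅y⁆⇒x≡y t t'∈t
    ... | refl | refl = Ex-irrefl _ x∈Ext'
    noP∩R : ∀ {x} → x ∈ ⁅ t ⁆ → x ∈ R t → ⊥₀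
    noP∩R x∈t x∈Rt with x∈⁅y⁆⇒x≡y t x∈t
    ... | refl = R-irrefl _ x∈Rt
    noR∩Ē : ∀ {x} → x ∈ R t → x ∈ Ē ⁅ t ⁆ → ⊥₀
    noR∩Ē x∈Rt x∈Ē with x∈Ē⁻ ⁅ t ⁆ x∈Ē
    ... | t' , t'∈t , x∈Ext' with x∈⁅y⁆⇒x≡y t t'∈t
    ... | refl = ∩≡⊥⁻ (R∩Ex≡⊥ t) x∈Rt x∈Ext'

  WFBasis : Basis → Set
  WFBasis Δ = ∀ v τ → typeOf Δ v ≡ just τ → WF τ

  module _ (elementWF : ∀ t → WF (⁅ t ⁆ , R t)) where
    wf-typedˢ : ∀ {Δ s τ} → WFBasis Δ → Δ ⊢ˢ s ∶ τ → WF τ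
    wf-typedˢ wfΔ (t-svar eq) = wfΔ _ _ eq
    wf-typedˢ wfΔ (t-evar eq) = wfΔ _ _ eq
    wf-typedˢ wfΔ t-ε = wf-empty
    wf-typedˢ wfΔ t-el = elementWF _
    wf-typedˢ wfΔ (t-· _ _ compat) = wf-conj compat

    wf-typed : ∀ {Δ p τ} → WFBasis Δ → Δ ⊢ p ∶ τ → WF τ
    wf-typed wfΔ (t-tvar eq) = wfΔ _ _ eq
    wf-typed wfΔ (t-seq ds) = wf-typedˢ wfΔ ds
    wf-typed wfΔ (t-∣ _ _ compat) = wf-conj compat
    wf-typed wfΔ (t-mem {P' = P'} ds _ _ _) = wf-membrane P' (wf-typedˢ wfΔ ds)

  closedˢ : ∀ {Δ Δ'} (s : Seq) {τ} → Δ ⊢ˢ ⌜ s ⌝ˢ ∶ τ → Δ' ⊢ˢ ⌜ s ⌝ˢ ∶ τ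
  closedˢ ε t-ε = t-ε
  closedˢ (el a) t-el = t-el
  closedˢ (s · s') (t-· ds ds' compat) = t-· (closedˢ s ds) (closedˢ s' ds') compat

  closed : ∀ {Δ Δ'} (u : Term) {τ} → Δ ⊢ ⌜ u ⌝ ∶ τ → Δ' ⊢ ⌜ u ⌝ ∶ τ
  closed (sq s) (t-seq ds) = t-seq (closedˢ s ds)
  closed (mem s u) (t-mem ds du compat inc) = t-mem (closedˢ s ds) (closed u du) compat inc
  closed (u ∣ u') (t-∣ du du' compat) = t-∣ (closed u du) (closed u' du') compat

  ⌜fill⌝ : ∀ C t → ⌜ fill C t ⌝ ≡ fillₚ C ⌜ t ⌝
  ⌜fill⌝ □ t = refl
  ⌜fill⌝ (C ∣ˡ u) t = cong (_∣ₚ ⌜ u ⌝) (⌜fill⌝ C t)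
  ⌜fill⌝ (u ∣ʳ C) t = cong (⌜ u ⌝ ∣ₚ_) (⌜fill⌝ C t)
  ⌜fill⌝ (memC s C) t = cong (memₚ ⌜ s ⌝ˢ) (⌜fill⌝ C t)

  infix 3 _⊢ᶜ_⇒_
  data _⊢ᶜ_⇒_ : Ctx → Ty → Ty → Set where
    c-□   : ∀ {τ} → □ ⊢ᶜ τ ⇒ τ
    c-∣ˡ  : ∀ {C u τ ρ ρ'} → C ⊢ᶜ τ ⇒ ρ → ⊢₀ u ∶ ρ' → ρ ⋈ ρ' → (C ∣ˡ u) ⊢ᶜ τ ⇒ conj ρ ρ'
    c-∣ʳ  : ∀ {C u τ ρ ρ'} → ⊢₀ u ∶ ρ' → C ⊢ᶜ τ ⇒ ρ → ρ' ⋈ ρ → (u ∣ʳ C) ⊢ᶜ τ ⇒ conj ρ' ρ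
    c-mem : ∀ {C s τ P Rr P' Rr'} → ⊢ˢ₀ s ∶ (P , Rr) → C ⊢ᶜ τ ⇒ (P' , Rr') →
            (P , Rr) ⋈ (P' , Rr') → Rr' ⊆ P → memC s C ⊢ᶜ τ ⇒ (P , Rr ─ P')

  fill-split : ∀ {Δ} C p {ρ} → Δ ⊢ fillₚ C p ∶ ρ → ∃ λ τ → (Δ ⊢ p ∶ τ) × (C ⊢ᶜ τ ⇒ ρ)
  fill-split □ p dp = _ , dp , c-□
  fill-split (C ∣ˡ u) p (t-∣ dC du compat) with fill-split C p dC
  ... | τ , dp , dC' = τ , dp , c-∣ˡ dC' (closed u du) compat
  fill-split (u ∣ʳ C) p (t-∣ du dC compat) with fill-split C p dC
  ... | τ , dp , dC' = τ , dp , c-∣ʳ (closed u du) dC' compat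
  fill-split (memC s C) p (t-mem ds dC compat inc) with fill-split C p dC
  ... | τ , dp , dC' = τ , dp , c-mem (closedˢ s ds) dC' compat inc

  fill-typed : ∀ {Δ} C p {τ ρ} → Δ ⊢ p ∶ τ → C ⊢ᶜ τ ⇒ ρ → Δ ⊢ fillₚ C p ∶ ρ
  fill-typed □ p dp c-□ = dp
  fill-typed (C ∣ˡ u) p dp (c-∣ˡ dC du compat) = t-∣ (fill-typed C p dp dC) (closed u du) compat
  fill-typed (u ∣ʳ C) p dp (c-∣ʳ du dC compat) = t-∣ (closed u du) (fill-typed C p dp dC) compat
  fill-typed (memC s C) p dp (c-mem ds dC compat inc) = t-mem (closedˢ s ds) (fill-typed C p dp dC) compat inc

  ∘ᶜ-split : ∀ C₁ C₂ {τ ρ} → (C₁ ∘ᶜ C₂) ⊢ᶜ τ ⇒ ρ → ∃ λ ρ₂ → (C₂ ⊢ᶜ τ ⇒ ρ₂) × (C₁ ⊢ᶜ ρ₂ ⇒ ρ)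
  ∘ᶜ-split □ C₂ dC = _ , dC , c-□
  ∘ᶜ-split (C ∣ˡ u) C₂ (c-∣ˡ dC du compat) with ∘ᶜ-split C C₂ dC
  ... | ρ₂ , d₂ , d₁ = ρ₂ , d₂ , c-∣ˡ d₁ du compat
  ∘ᶜ-split (u ∣ʳ C) C₂ (c-∣ʳ du dC compat) with ∘ᶜ-split C C₂ dC
  ... | ρ₂ , d₂ , d₁ = ρ₂ , d₂ , c-∣ʳ du d₁ compat
  ∘ᶜ-split (memC s C) C₂ (c-mem ds dC compat inc) with ∘ᶜ-split C C₂ dC
  ... | ρ₂ , d₂ , d₁ = ρ₂ , d₂ , c-mem ds d₁ compat inc

  ∘ᶜ-typed : ∀ C₁ C₂ {τ ρ₂ ρ} → C₂ ⊢ᶜ τ ⇒ ρ₂ → C₁ ⊢ᶜ ρ₂ ⇒ ρ → (C₁ ∘ᶜ C₂) ⊢ᶜ τ ⇒ ρ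
  ∘ᶜ-typed □ C₂ d₂ c-□ = d₂
  ∘ᶜ-typed (C ∣ˡ u) C₂ d₂ (c-∣ˡ d₁ du compat) = c-∣ˡ (∘ᶜ-typed C C₂ d₂ d₁) du compat
  ∘ᶜ-typed (u ∣ʳ C) C₂ d₂ (c-∣ʳ du d₁ compat) = c-∣ʳ du (∘ᶜ-typed C C₂ d₂ d₁) compat
  ∘ᶜ-typed (memC s C) C₂ d₂ (c-mem ds d₁ compat inc) = c-mem ds (∘ᶜ-typed C C₂ d₂ d₁) compat inc

  single-here : ∀ Y τ → typeOf (single Y τ) (tv Y) ≡ just τ
  single-here Y τ with Y ≟ℕ Y
  ... | yes _ = refl
  ... | no Y≢Y = ⊥-elim (Y≢Y refl)

  hole⁻ : ∀ Y τ C {ρ} → single Y τ ⊢ fillₚ C (tvar Y) ∶ ρ → C ⊢ᶜ τ ⇒ ρ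
  hole⁻ Y τ C dC with fill-split C (tvar Y) dC
  ... | τ' , t-tvar eq , dC' with just-injective (trans (sym (single-here Y τ)) eq)
  ... | refl = dC'

  hole⁺ : ∀ Y τ C {ρ} → C ⊢ᶜ τ ⇒ ρ → single Y τ ⊢ fillₚ C (tvar Y) ∶ ρ
  hole⁺ Y τ C dC = fill-typed C (tvar Y) (t-tvar (single-here Y τ)) dC

  tyAt : TyMap → Var → Ty
  tyAt m v = pM m v , rM m v

  Represents : Basis → TyMap → Var → Set
  Represents Δ m (ev x) = typeOf Δ (ev x) ≡ just (⁅ eM m x ⁆ , R (eM m x)) × rM m (ev x) ≡ R (eM m x)
  Represents Δ m v = typeOf Δ v ≡ just (tyAt m v)

  RepresentsAll : Basis → TyMap → List Var → Set
  RepresentsAll Δ m Θ = ∀ {v} → v ∈ₗ Θ → Represents Δ m v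

  represents-++ˡ : ∀ {Δ m} Θ {Θ'} → RepresentsAll Δ m (Θ ++ Θ') → RepresentsAll Δ m Θ
  represents-++ˡ Θ rep v∈ = rep (∈-++⁺ˡ v∈)

  represents-++ʳ : ∀ {Δ m} Θ {Θ'} → RepresentsAll Δ m (Θ ++ Θ') → RepresentsAll Δ m Θ'
  represents-++ʳ Θ rep v∈ = rep (∈-++⁺ʳ Θ v∈)

  sat-++³⁻ : ∀ {m} (Ξ₁ Ξ₂ Ξ₃ : List Constraint) → m ⊨* (Ξ₁ ++ Ξ₂ ++ Ξ₃) →
             m ⊨* Ξ₁ × m ⊨* Ξ₂ × m ⊨* Ξ₃
  sat-++³⁻ Ξ₁ Ξ₂ Ξ₃ sat with ++⁻ Ξ₁ sat
  ... | sat₁ , sat₂₃ with ++⁻ Ξ₂ sat₂₃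
  ... | sat₂ , sat₃ = sat₁ , sat₂ , sat₃

  inferSoundˢ : ∀ {Δ m s Θ Φ Ψ Ξ} → s ⊳ˢ (Θ , Φ , Ψ , Ξ) → RepresentsAll Δ m Θ → m ⊨* Ξ →
                Δ ⊢ˢ s ∶ (⟦ Φ ⟧ m , ⟦ Ψ ⟧ m)
  inferSoundˢ i-ε rep sat = t-ε
  inferSoundˢ i-el rep sat = t-el
  inferSoundˢ {m = m} (i-evar {x}) rep sat with rep (here refl)
  ... | eq , ψ≡R = t-evar (trans eq (cong (λ r → just (⁅ eM m x ⁆ , r)) (sym ψ≡R)))
  inferSoundˢ i-svar rep sat = t-svar (rep (here refl))
  inferSoundˢ (i-· {Θ = Θ} {Ξ = Ξ} {Ξ' = Ξ'} is is') rep sat with sat-++³⁻ Ξ Ξ' _ sat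
  ... | sat₁ , sat₂ , (compat ∷ []) =
    t-· (inferSoundˢ is (represents-++ˡ Θ rep) sat₁) (inferSoundˢ is' (represents-++ʳ Θ rep) sat₂) compat

  inferSound : ∀ {Δ m p Θ Φ Ψ Ξ} → p ⊳ (Θ , Φ , Ψ , Ξ) → RepresentsAll Δ m Θ → m ⊨* Ξ →
               Δ ⊢ p ∶ (⟦ Φ ⟧ m , ⟦ Ψ ⟧ m)
  inferSound (i-seq is) rep sat = t-seq (inferSoundˢ is rep sat)
  inferSound i-tvar rep sat = t-tvar (rep (here refl))
  inferSound (i-∣ {Θ = Θ} {Ξ = Ξ} {Ξ' = Ξ'} ip ip') rep sat with sat-++³⁻ Ξ Ξ' _ sat
  ... | sat₁ , sat₂ , (compat ∷ []) =
    t-∣ (inferSound ip (represents-++ˡ Θ rep) sat₁) (inferSound ip' (represents-++ʳ Θ rep) sat₂) compat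
  inferSound (i-mem {Θ = Θ} {Ξ = Ξ} {Ξ' = Ξ'} is ip) rep sat with sat-++³⁻ Ξ Ξ' _ sat
  ... | sat₁ , sat₂ , (compat ∷ inc ∷ []) =
    t-mem (inferSoundˢ is (represents-++ˡ Θ rep) sat₁) (inferSound ip (represents-++ʳ Θ rep) sat₂) compat inc

  inferCompleteˢ : ∀ {Δ m s Θ Φ Ψ Ξ τ} → s ⊳ˢ (Θ , Φ , Ψ , Ξ) → RepresentsAll Δ m Θ →
                   Δ ⊢ˢ s ∶ τ → m ⊨* Ξ × τ ≡ (⟦ Φ ⟧ m , ⟦ Ψ ⟧ m)
  inferCompleteˢ i-ε rep t-ε = [] , refl
  inferCompleteˢ i-el rep t-el = [] , refl
  inferCompleteˢ i-evar rep (t-evar eq) with rep (here refl)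
  ... | eq' , ψ≡R with just-injective (trans (sym eq') eq)
  ... | refl = (ψ≡R ∷ []) , cong (_ ,_) (sym ψ≡R)
  inferCompleteˢ i-svar rep (t-svar eq) with just-injective (trans (sym (rep (here refl))) eq)
  ... | refl = [] , refl
  inferCompleteˢ (i-· {Θ = Θ} is is') rep (t-· ds ds' compat)
    with inferCompleteˢ is (represents-++ˡ Θ rep) ds | inferCompleteˢ is' (represents-++ʳ Θ rep) ds'
  ... | sat₁ , refl | sat₂ , refl = ++⁺ sat₁ (++⁺ sat₂ (compat ∷ [])) , refl

  inferComplete : ∀ {Δ m p Θ Φ Ψ Ξ τ} → p ⊳ (Θ , Φ , Ψ , Ξ) → RepresentsAll Δ m Θ →
                  Δ ⊢ p ∶ τ → m ⊨* Ξ × τ ≡ (⟦ Φ ⟧ m , ⟦ Ψ ⟧ m)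
  inferComplete (i-seq is) rep (t-seq ds) = inferCompleteˢ is rep ds
  inferComplete i-tvar rep (t-tvar eq) with just-injective (trans (sym (rep (here refl))) eq)
  ... | refl = [] , refl
  inferComplete (i-∣ {Θ = Θ} ip ip') rep (t-∣ dp dp' compat)
    with inferComplete ip (represents-++ˡ Θ rep) dp | inferComplete ip' (represents-++ʳ Θ rep) dp'
  ... | sat₁ , refl | sat₂ , refl = ++⁺ sat₁ (++⁺ sat₂ (compat ∷ [])) , refl
  inferComplete (i-mem {Θ = Θ} is ip) rep (t-mem ds dp compat inc)
    with inferCompleteˢ is (represents-++ˡ Θ rep) ds | inferComplete ip (represents-++ʳ Θ rep) dp
  ... | sat₁ , refl | sat₂ , refl = ++⁺ sat₁ (++⁺ sat₂ (compat ∷ inc ∷ [])) , refl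

  inferredVarsTypedˢ : ∀ {Δ s Θ Φ Ψ Ξ τ} → s ⊳ˢ (Θ , Φ , Ψ , Ξ) → Δ ⊢ˢ s ∶ τ →
                       ∀ {v} → v ∈ₗ Θ → ∃ λ τ' → typeOf Δ v ≡ just τ'
  inferredVarsTypedˢ i-evar (t-evar eq) (here refl) = _ , eq
  inferredVarsTypedˢ i-svar (t-svar eq) (here refl) = _ , eq
  inferredVarsTypedˢ (i-· {Θ = Θ} is is') (t-· ds ds' _) v∈ with ∈-++⁻ Θ v∈
  ... | inj₁ v∈Θ = inferredVarsTypedˢ is ds v∈Θ
  ... | inj₂ v∈Θ' = inferredVarsTypedˢ is' ds' v∈Θ'

  inferredVarsTyped : ∀ {Δ p Θ Φ Ψ Ξ τ} → p ⊳ (Θ , Φ , Ψ , Ξ) → Δ ⊢ p ∶ τ →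
                      ∀ {v} → v ∈ₗ Θ → ∃ λ τ' → typeOf Δ v ≡ just τ'
  inferredVarsTyped (i-seq is) (t-seq ds) v∈ = inferredVarsTypedˢ is ds v∈
  inferredVarsTyped i-tvar (t-tvar eq) (here refl) = _ , eq
  inferredVarsTyped (i-∣ {Θ = Θ} ip ip') (t-∣ dp dp' _) v∈ with ∈-++⁻ Θ v∈
  ... | inj₁ v∈Θ = inferredVarsTyped ip dp v∈Θ
  ... | inj₂ v∈Θ' = inferredVarsTyped ip' dp' v∈Θ'
  inferredVarsTyped (i-mem {Θ = Θ} is ip) (t-mem ds dp _ _) v∈ with ∈-++⁻ Θ v∈
  ... | inj₁ v∈Θ = inferredVarsTypedˢ is ds v∈Θ
  ... | inj₂ v∈Θ' = inferredVarsTyped ip dp v∈Θ'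

  data VarAt : ℕ → Pat → Set where
    at-var : ∀ {y} → VarAt 0 (tvar y)
    at-∣ˡ  : ∀ {d p q} → VarAt d p → VarAt d (p ∣ₚ q)
    at-∣ʳ  : ∀ {d p q} → VarAt d q → VarAt d (p ∣ₚ q)
    at-mem : ∀ {d s p} → VarAt d p → VarAt (suc d) (memₚ s p)

  closed-noVar : ∀ u {d} → ¬ VarAt d ⌜ u ⌝
  closed-noVar (mem s u) (at-mem at) = closed-noVar u at
  closed-noVar (u ∣ u') (at-∣ˡ at) = closed-noVar u at
  closed-noVar (u ∣ u') (at-∣ʳ at) = closed-noVar u' at

  VarAt-≅ : ∀ {p q d} → p ≅ q → (VarAt d p → VarAt d q) × (VarAt d q → VarAt d p)
  VarAt-≅ ≅-refl = id , id
  VarAt-≅ (≅-sym eq) with VarAt-≅ eq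
  ... | to , from = from , to
  VarAt-≅ (≅-trans eq eq') with VarAt-≅ eq | VarAt-≅ eq'
  ... | to , from | to' , from' = to' ∘ to , from ∘ from'
  VarAt-≅ (≅-seq _) = (λ ()) , (λ ())
  VarAt-≅ (≅-mem _ eq) =
    (λ { (at-mem at) → at-mem (proj₁ (VarAt-≅ eq) at) }) ,
    (λ { (at-mem at) → at-mem (proj₂ (VarAt-≅ eq) at) })
  VarAt-≅ (≅-par eq eq') =
    (λ { (at-∣ˡ at) → at-∣ˡ (proj₁ (VarAt-≅ eq) at) ; (at-∣ʳ at) → at-∣ʳ (proj₁ (VarAt-≅ eq') at) }) ,
    (λ { (at-∣ˡ at) → at-∣ˡ (proj₂ (VarAt-≅ eq) at) ; (at-∣ʳ at) → at-∣ʳ (proj₂ (VarAt-≅ eq') at) })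
  VarAt-≅ ≅-assoc =
    (λ { (at-∣ˡ (at-∣ˡ at)) → at-∣ˡ at ; (at-∣ˡ (at-∣ʳ at)) → at-∣ʳ (at-∣ˡ at) ; (at-∣ʳ at) → at-∣ʳ (at-∣ʳ at) }) ,
    (λ { (at-∣ˡ at) → at-∣ˡ (at-∣ˡ at) ; (at-∣ʳ (at-∣ˡ at)) → at-∣ˡ (at-∣ʳ at) ; (at-∣ʳ (at-∣ʳ at)) → at-∣ʳ at })
  VarAt-≅ ≅-comm =
    (λ { (at-∣ˡ at) → at-∣ʳ at ; (at-∣ʳ at) → at-∣ˡ at }) ,
    (λ { (at-∣ˡ at) → at-∣ʳ at ; (at-∣ʳ at) → at-∣ˡ at })
  VarAt-≅ ≅-unit = (λ { (at-∣ˡ at) → at ; (at-∣ʳ ()) }) , at-∣ˡ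
  VarAt-≅ ≅-memε = (λ { (at-mem ()) }) , (λ ())
  VarAt-≅ ≅-rot = (λ { (at-mem at) → at-mem at }) , (λ { (at-mem at) → at-mem at })

  VarAt-fill : ∀ C {d X Y} → VarAt d (fillₚ C (tvar X)) → VarAt d (fillₚ C (tvar Y))
  VarAt-fill □ at-var = at-var
  VarAt-fill (C ∣ˡ u) (at-∣ˡ at) = at-∣ˡ (VarAt-fill C at)
  VarAt-fill (C ∣ˡ u) (at-∣ʳ at) = ⊥-elim (closed-noVar u at)
  VarAt-fill (u ∣ʳ C) (at-∣ˡ at) = ⊥-elim (closed-noVar u at)
  VarAt-fill (u ∣ʳ C) (at-∣ʳ at) = at-∣ʳ (VarAt-fill C at)
  VarAt-fill (memC s C) (at-mem at) = at-mem (VarAt-fill C at)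

  deepShape : Seq → Seq → Term → Term → Ctx
  deepShape S₁ S₂ T₁ T₂ = memC S₂ (memC S₁ (□ ∣ˡ T₁) ∣ˡ T₂)

  deepShape-depth : ∀ S₁ S₂ T₁ T₂ {d} → VarAt d (fillₚ (deepShape S₁ S₂ T₁ T₂) (tvar 0)) → d ≡ 2
  deepShape-depth S₁ S₂ T₁ T₂ (at-mem (at-∣ˡ (at-mem (at-∣ˡ at-var)))) = refl
  deepShape-depth S₁ S₂ T₁ T₂ (at-mem (at-∣ˡ (at-mem (at-∣ʳ at)))) = ⊥-elim (closed-noVar T₁ at)
  deepShape-depth S₁ S₂ T₁ T₂ (at-mem (at-∣ʳ at)) = ⊥-elim (closed-noVar T₂ at)

  module Occurrences (X : ℕ) where
    noOccˢ : ∀ {s Θ Φ Ψ Ξ} → s ⊳ˢ (Θ , Φ , Ψ , Ξ) → ¬ OccX X Φ × ¬ OccX X Ψ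
    noOccˢ i-ε = (λ ()) , (λ ())
    noOccˢ i-el = (λ ()) , (λ ())
    noOccˢ i-evar = (λ ()) , (λ ())
    noOccˢ i-svar = (λ ()) , (λ ())
    noOccˢ (i-· is is') with noOccˢ is | noOccˢ is'
    ... | noΦ , noΨ | noΦ' , noΨ' =
      (λ { (occ-∪ˡ o) → noΦ o ; (occ-∪ʳ o) → noΦ' o }) ,
      (λ { (occ-∖ˡ (occ-∪ˡ o)) → noΨ o ; (occ-∖ˡ (occ-∪ʳ o)) → noΨ' o
         ; (occ-∖ʳ (occ-∪ˡ o)) → noΦ o ; (occ-∖ʳ (occ-∪ʳ o)) → noΦ' o })

    occΦ⇒depth0 : ∀ {p Θ Φ Ψ Ξ} → p ⊳ (Θ , Φ , Ψ , Ξ) → OccX X Φ → VarAt 0 p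
    occΦ⇒depth0 (i-seq is) o = ⊥-elim (proj₁ (noOccˢ is) o)
    occΦ⇒depth0 i-tvar o = at-var
    occΦ⇒depth0 (i-∣ ip ip') (occ-∪ˡ o) = at-∣ˡ (occΦ⇒depth0 ip o)
    occΦ⇒depth0 (i-∣ ip ip') (occ-∪ʳ o) = at-∣ʳ (occΦ⇒depth0 ip' o)
    occΦ⇒depth0 (i-mem is ip) o = ⊥-elim (proj₁ (noOccˢ is) o)

    occΨ⇒depth≤1 : ∀ {p Θ Φ Ψ Ξ} → p ⊳ (Θ , Φ , Ψ , Ξ) → OccX X Ψ → VarAt 0 p ⊎ VarAt 1 p
    occΨ⇒depth≤1 (i-seq is) o = ⊥-elim (proj₂ (noOccˢ is) o)
    occΨ⇒depth≤1 i-tvar o = inj₁ at-var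
    occΨ⇒depth≤1 (i-∣ ip ip') (occ-∖ˡ (occ-∪ˡ o)) = Data.Sum.map at-∣ˡ at-∣ˡ (occΨ⇒depth≤1 ip o)
    occΨ⇒depth≤1 (i-∣ ip ip') (occ-∖ˡ (occ-∪ʳ o)) = Data.Sum.map at-∣ʳ at-∣ʳ (occΨ⇒depth≤1 ip' o)
    occΨ⇒depth≤1 (i-∣ ip ip') (occ-∖ʳ (occ-∪ˡ o)) = inj₁ (at-∣ˡ (occΦ⇒depth0 ip o))
    occΨ⇒depth≤1 (i-∣ ip ip') (occ-∖ʳ (occ-∪ʳ o)) = inj₁ (at-∣ʳ (occΦ⇒depth0 ip' o))
    occΨ⇒depth≤1 (i-mem is ip) (occ-∖ˡ o) = ⊥-elim (proj₂ (noOccˢ is) o)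
    occΨ⇒depth≤1 (i-mem is ip) (occ-∖ʳ o) = inj₂ (at-mem (occΦ⇒depth0 ip o))

    deepCore-noOcc : ∀ C₂ {S₁ S₂ T₁ T₂ Θ Φ' Ψ' Ξ'} → C₂ ≅ᶜ deepShape S₁ S₂ T₁ T₂ →
                     fillₚ C₂ (tvar X) ⊳ (Θ , Φ' , Ψ' , Ξ') → ¬ OccX X Φ' × ¬ OccX X Ψ'
    deepCore-noOcc C₂ {S₁} {S₂} {T₁} {T₂} C₂≅ ip =
      (λ o → 0≢2 (depth (occΦ⇒depth0 ip o))) ,
      (λ o → [ 0≢2 ∘ depth , 1≢2 ∘ depth ]′ (occΨ⇒depth≤1 ip o))
      where
      depth : ∀ {d} → VarAt d (fillₚ C₂ (tvar X)) → d ≡ 2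
      depth at = deepShape-depth S₁ S₂ T₁ T₂ (proj₁ (VarAt-≅ C₂≅) (VarAt-fill C₂ at))
      0≢2 : 0 ≢ 2
      0≢2 ()
      1≢2 : 1 ≢ 2
      1≢2 ()

  open Occurrences using (deepCore-noOcc)

  _≟ᵥ_ : (u v : Var) → Dec (u ≡ v)
  tv a ≟ᵥ tv b = map′ (cong tv) (λ { refl → refl }) (a ≟ℕ b)
  sv a ≟ᵥ sv b = map′ (cong sv) (λ { refl → refl }) (a ≟ℕ b)
  ev a ≟ᵥ ev b = map′ (cong ev) (λ { refl → refl }) (a ≟ℕ b)
  tv _ ≟ᵥ sv _ = no λ ()
  tv _ ≟ᵥ ev _ = no λ ()
  sv _ ≟ᵥ tv _ = no λ ()
  sv _ ≟ᵥ ev _ = no λ ()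
  ev _ ≟ᵥ tv _ = no λ ()
  ev _ ≟ᵥ sv _ = no λ ()

  updateAt : {A : Set} → ℕ → A → (Var → A) → Var → A
  updateAt X a f v with v ≟ᵥ tv X
  ... | yes _ = a
  ... | no _ = f v

  updateAt-here : ∀ {A} X (a : A) f → updateAt X a f (tv X) ≡ a
  updateAt-here X a f with tv X ≟ᵥ tv X
  ... | yes _ = refl
  ... | no X≢X = ⊥-elim (X≢X refl)

  updateAt-elsewhere : ∀ {A} X (a : A) f v → v ≢ tv X → updateAt X a f v ≡ f v
  updateAt-elsewhere X a f v v≢X with v ≟ᵥ tv X
  ... | yes v≡X = ⊥-elim (v≢X v≡X)
  ... | no _ = refl

  mkTyMap : (ℕ → Fin n) → (Var → Ty) → TyMap
  mkTyMap e f = record { eM = e ; pM = λ v → proj₁ (f v) ; rM = λ v → proj₂ (f v) }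

  _[_≔_] : TyMap → ℕ → Ty → TyMap
  m [ X ≔ τ ] = mkTyMap (eM m) (updateAt X τ (tyAt m))

  occurs-or-invariant : ∀ X m τ e → OccX X e ⊎ ⟦ e ⟧ m ≡ ⟦ e ⟧ (m [ X ≔ τ ])
  occurs-or-invariant X m τ (lit _) = inj₂ refl
  occurs-or-invariant X m τ (sing _) = inj₂ refl
  occurs-or-invariant X m τ (Rof _) = inj₂ refl
  occurs-or-invariant X m τ (pv v) with v ≟ᵥ tv X
  ... | yes refl = inj₁ occ-p
  ... | no _ = inj₂ refl
  occurs-or-invariant X m τ (rv v) with v ≟ᵥ tv X
  ... | yes refl = inj₁ occ-r
  ... | no _ = inj₂ refl
  occurs-or-invariant X m τ (e ∪ₑ e') with occurs-or-invariant X m τ e | occurs-or-invariant X m τ e'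
  ... | inj₁ o | _ = inj₁ (occ-∪ˡ o)
  ... | inj₂ _ | inj₁ o = inj₁ (occ-∪ʳ o)
  ... | inj₂ eq | inj₂ eq' = inj₂ (cong₂ _∪_ eq eq')
  occurs-or-invariant X m τ (e ∖ₑ e') with occurs-or-invariant X m τ e | occurs-or-invariant X m τ e'
  ... | inj₁ o | _ = inj₁ (occ-∖ˡ o)
  ... | inj₂ _ | inj₁ o = inj₁ (occ-∖ʳ o)
  ... | inj₂ eq | inj₂ eq' = inj₂ (cong₂ _─_ eq eq')

  invariant : ∀ X m τ e → ¬ OccX X e → ⟦ e ⟧ m ≡ ⟦ e ⟧ (m [ X ≔ τ ])
  invariant X m τ e noOcc = [ ⊥-elim ∘ noOcc , id ]′ (occurs-or-invariant X m τ e)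

  module ContextInference (X : ℕ) (C : Ctx) {Φ' Ψ' : SExp} {Ξ' : List Constraint}
    (inferC : fillₚ C (tvar X) ⊳ ([ tv X ] , Φ' , Ψ' , Ξ')) where

    singleX : ∀ m → RepresentsAll (single X (tyAt m (tv X))) m [ tv X ]
    singleX m (here refl) = single-here X (tyAt m (tv X))

    contextSound : ∀ m → m ⊨* Ξ' → C ⊢ᶜ tyAt m (tv X) ⇒ (⟦ Φ' ⟧ m , ⟦ Ψ' ⟧ m)
    contextSound m sat = hole⁻ X (tyAt m (tv X)) C (inferSound inferC (singleX m) sat)

    contextComplete : ∀ m {ρ} → C ⊢ᶜ tyAt m (tv X) ⇒ ρ → m ⊨* Ξ' × ρ ≡ (⟦ Φ' ⟧ m , ⟦ Ψ' ⟧ m)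
    contextComplete m dC = inferComplete inferC (singleX m) (hole⁺ X (tyAt m (tv X)) C dC)

    contextType : ∀ m {τ ρ} → C ⊢ᶜ τ ⇒ ρ → ρ ≡ (⟦ Φ' ⟧ (m [ X ≔ τ ]) , ⟦ Ψ' ⟧ (m [ X ≔ τ ]))
    contextType m {τ} dC =
      proj₂ (contextComplete (m [ X ≔ τ ]) (subst (C ⊢ᶜ_⇒ _) (sym (updateAt-here X τ (tyAt m))) dC))

  coreNecessary : ∀ X m C C₀ → IsCore C C₀ → ∀ {Φ' Ψ' Ξ'} →
                  fillₚ C₀ (tvar X) ⊳ ([ tv X ] , Φ' , Ψ' , Ξ') →
                  ∀ {P'} → C ⊢ᶜ tyAt m (tv X) ⇒ (P' , ⊥) →
                  m ⊨* Ξ' × (OccX X Ψ' → ⟦ Ψ' ⟧ m ≡ ⊥)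
  coreNecessary X m C .C (core₁ _) inferC dC with ContextInference.contextComplete X C inferC m dC
  ... | sat , eq = sat , λ _ → sym (cong proj₂ eq)
  coreNecessary X m C .C (core₂ _) inferC dC with ContextInference.contextComplete X C inferC m dC
  ... | sat , eq = sat , λ _ → sym (cong proj₂ eq)
  coreNecessary X m .(C₁ ∘ᶜ C₂) .C₂ (core₃ {C₁} {C₂} refl C₂≅) inferC dC with ∘ᶜ-split C₁ C₂ dC
  ... | _ , dC₂ , _ =
    proj₁ (ContextInference.contextComplete X C₂ inferC m dC₂) ,
    ⊥-elim ∘ proj₂ (deepCore-noOcc X C₂ C₂≅ inferC)

  -- Sufficiency when the core is C itself: if ψ_X, φ_X do not occur in Ψ',
  -- the evaluation of Ψ' is that of the given typing of C, namely ∅.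
  wholeCoreSufficient : ∀ X m C {Φ' Ψ' Ξ'} → fillₚ C (tvar X) ⊳ ([ tv X ] , Φ' , Ψ' , Ξ') →
                        ∀ {τ₁ P} → C ⊢ᶜ τ₁ ⇒ (P , ⊥) → m ⊨* Ξ' → (OccX X Ψ' → ⟦ Ψ' ⟧ m ≡ ⊥) →
                        ∃ λ P' → C ⊢ᶜ tyAt m (tv X) ⇒ (P' , ⊥)
  wholeCoreSufficient X m C {Φ'} {Ψ'} inferC {τ₁} dC sat occ =
    ⟦ Φ' ⟧ m , subst (λ r → C ⊢ᶜ tyAt m (tv X) ⇒ (⟦ Φ' ⟧ m , r)) Ψ'≡⊥ (contextSound m sat)
    where
    open ContextInference X C inferC
    Ψ'≡⊥ : ⟦ Ψ' ⟧ m ≡ ⊥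
    Ψ'≡⊥ = [ occ , (λ eq → trans eq (sym (cong proj₂ (contextType m dC)))) ]′
             (occurs-or-invariant X m τ₁ Ψ')

  coreSufficient : ∀ X m C C₀ → IsCore C C₀ → ∀ {Φ' Ψ' Ξ'} →
                   fillₚ C₀ (tvar X) ⊳ ([ tv X ] , Φ' , Ψ' , Ξ') →
                   ∀ {τ₁ P} → C ⊢ᶜ τ₁ ⇒ (P , ⊥) → m ⊨* Ξ' → (OccX X Ψ' → ⟦ Ψ' ⟧ m ≡ ⊥) →
                   ∃ λ P' → C ⊢ᶜ tyAt m (tv X) ⇒ (P' , ⊥)
  coreSufficient X m C .C (core₁ _) inferC dC sat occ = wholeCoreSufficient X m C inferC dC sat occ
  coreSufficient X m C .C (core₂ _) inferC dC sat occ = wholeCoreSufficient X m C inferC dC sat occ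
  coreSufficient X m .(C₁ ∘ᶜ C₂) .C₂ (core₃ {C₁} {C₂} refl C₂≅) {Φ'} {Ψ'} inferC {τ₁} {P} dC sat _
    with ∘ᶜ-split C₁ C₂ dC
  ... | ρ₂ , dC₂ , dC₁ = P , ∘ᶜ-typed C₁ C₂ (subst (C₂ ⊢ᶜ tyAt m (tv X) ⇒_) coreType (contextSound m sat)) dC₁
    where
    open ContextInference X C₂ inferC
    -- φ_X, ψ_X do not occur, so the core's type is the one it has with hole type τ₁.
    coreType : (⟦ Φ' ⟧ m , ⟦ Ψ' ⟧ m) ≡ ρ₂
    coreType with deepCore-noOcc X C₂ C₂≅ inferC
    ... | noΦ , noΨ = trans (cong₂ _,_ (invariant X m τ₁ Φ' noΦ) (invariant X m τ₁ Ψ' noΨ))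
                            (sym (contextType m dC₂))

  contextTyping : ∀ C {t ρ} → ⊢₀ fill C t ∶ ρ → ∃ λ τ → C ⊢ᶜ τ ⇒ ρ
  contextTyping C {t} dCt with fill-split C ⌜ t ⌝ (subst (emptyBasis ⊢_∶ _) (⌜fill⌝ C t) dCt)
  ... | τ , _ , dC = τ , dC

  -- The types of a basis, with ⟨∅,∅⟩ for unassigned variables.
  assigned : Basis → Var → Ty
  assigned Δ v = fromMaybe (⊥ , ⊥) (typeOf Δ v)

  forwardMap : ℕ → Inst → Basis → Ty → TyMap
  forwardMap X σ Δ τ = mkTyMap (λ x → Γ (eσ σ x)) (updateAt X τ (assigned Δ))

  forwardMap-at : ∀ X σ Δ τ v {τ'} → v ≢ tv X → typeOf Δ v ≡ just τ' → tyAt (forwardMap X σ Δ τ) v ≡ τ'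
  forwardMap-at X σ Δ τ v v≢X eq = trans (updateAt-elsewhere X τ (assigned Δ) v v≢X) (cong (fromMaybe _) eq)

  elementType : ∀ {a τ} → emptyBasis ⊢ˢ elₚ a ∶ τ → τ ≡ (⁅ Γ a ⁆ , R (Γ a))
  elementType t-el = refl

  forwardMap-var : ∀ X σ Δ τ → Agrees σ Δ → ∀ v → v ≢ tv X → ∃ (λ τ' → typeOf Δ v ≡ just τ') →
                   Represents Δ (forwardMap X σ Δ τ) v × MatchesVar (forwardMap X σ Δ τ) σ v
  forwardMap-var X σ Δ τ agrees (tv x) v≢X (τ' , eq) =
    trans eq (cong just (sym at)) , subst (⊢₀ tσ σ x ∶_) (sym at) (agrees (tv x) τ' eq)
    where at = forwardMap-at X σ Δ τ (tv x) v≢X eq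
  forwardMap-var X σ Δ τ agrees (sv x) v≢X (τ' , eq) =
    trans eq (cong just (sym at)) , subst (⊢ˢ₀ sσ σ x ∶_) (sym at) (agrees (sv x) τ' eq)
    where at = forwardMap-at X σ Δ τ (sv x) v≢X eq
  forwardMap-var X σ Δ τ agrees (ev x) v≢X (τ' , eq) =
    (trans eq (cong just τ'≡) , ψ≡R) , (refl , ψ≡R)
    where
    τ'≡ = elementType (agrees (ev x) τ' eq)
    ψ≡R = cong proj₂ (trans (forwardMap-at X σ Δ τ (ev x) v≢X eq) τ'≡)

  applicable⇒solution : ∀ {P₁ P₂ C σ X Θ Φ Ψ Ξ C₀ Φ' Ψ' Ξ'} → P₂ ⊳ (Θ , Φ , Ψ , Ξ) → tv X ∉ₗ Θ →
    IsCore C C₀ → fillₚ C₀ (tvar X) ⊳ ([ tv X ] , Φ' , Ψ' , Ξ') → Applicable P₁ P₂ C σ →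
    Σ TyMap λ m → Matches m σ Θ ×
      m ⊨* (Ξ ++ Ξ' ++ ((Φ ≐ pv (tv X)) ∷ (Ψ ≐ rv (tv X)) ∷ [])) × (OccX X Ψ' → m ⊨ (Ψ' ≐ lit ⊥))
  applicable⇒solution {C = C} {σ} {X} {Θ} {C₀ = C₀} inferP₂ X∉Θ core inferC (Δ , τ , agrees , dP₂ , _ , P' , dC) =
    m , (λ v∈ → proj₂ (onΘ v∈)) ,
    ++⁺ satΞ (++⁺ (proj₁ contextSolved) (sym (cong proj₁ τ≡) ∷ sym (cong proj₂ τ≡) ∷ [])) ,
    proj₂ contextSolved
    where
    m = forwardMap X σ Δ τ
    τ-at-X : tyAt m (tv X) ≡ τ
    τ-at-X = updateAt-here X τ (assigned Δ)
    onΘ : ∀ {v} → v ∈ₗ Θ → Represents Δ m v × MatchesVar m σ v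
    onΘ v∈ = forwardMap-var X σ Δ τ agrees _ (λ { refl → X∉Θ v∈ }) (inferredVarsTyped inferP₂ dP₂ v∈)
    P₂-typed = inferComplete inferP₂ (λ v∈ → proj₁ (onΘ v∈)) dP₂
    satΞ = proj₁ P₂-typed
    τ≡ : tyAt m (tv X) ≡ _
    τ≡ = trans τ-at-X (proj₂ P₂-typed)
    contextSolved = coreNecessary X m C C₀ core inferC (subst (C ⊢ᶜ_⇒ (P' , ⊥)) (sym τ-at-X) (hole⁻ 0 τ C dC))

  open DecMembership _≟ᵥ_ using (_∈?_)

  restrictTo : List Var → (Var → Ty) → Var → Maybe Ty
  restrictTo Θ f v with v ∈? Θ
  ... | yes _ = just (f v)
  ... | no _ = nothing

  restrictTo-∈ : ∀ Θ f {v} → v ∈ₗ Θ → restrictTo Θ f v ≡ just (f v)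
  restrictTo-∈ Θ f {v} v∈ with v ∈? Θ
  ... | yes _ = refl
  ... | no v∉ = ⊥-elim (v∉ v∈)

  restrictTo-just : ∀ Θ f v {τ} → restrictTo Θ f v ≡ just τ → v ∈ₗ Θ × f v ≡ τ
  restrictTo-just Θ f v eq with v ∈? Θ
  restrictTo-just Θ f v eq | yes v∈ = v∈ , just-injective eq
  restrictTo-just Θ f v () | no _

  prescribed : TyMap → Var → Ty
  prescribed m (ev x) = ⁅ eM m x ⁆ , R (eM m x)
  prescribed m v = tyAt m v

  basisOn : TyMap → List Var → Basis
  basisOn m Θ = record
    { typeOf = restrictTo Θ (prescribed m)
    ; evShape = λ x τ eq → eM m x , sym (proj₂ (restrictTo-just Θ (prescribed m) (ev x) eq)) }

  module _ (m : TyMap) (σ : Inst) (Θ : List Var) (matches : Matches m σ Θ) where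
    basisOn-represents : RepresentsAll (basisOn m Θ) m Θ
    basisOn-represents {tv x} v∈ = restrictTo-∈ Θ (prescribed m) v∈
    basisOn-represents {sv x} v∈ = restrictTo-∈ Θ (prescribed m) v∈
    basisOn-represents {ev x} v∈ =
      restrictTo-∈ Θ (prescribed m) v∈ , trans (proj₂ (matches v∈)) (cong R (sym (proj₁ (matches v∈))))

    basisOn-agrees : Agrees σ (basisOn m Θ)
    basisOn-agrees v τ eq with restrictTo-just Θ (prescribed m) v eq
    basisOn-agrees (tv x) τ eq | v∈ , refl = matches v∈
    basisOn-agrees (sv x) τ eq | v∈ , refl = matches v∈
    basisOn-agrees (ev x) τ eq | v∈ , refl rewrite proj₁ (matches v∈) = t-el

    basisOn-wf : (∀ t → WF (⁅ t ⁆ , R t)) → WFBasis (basisOn m Θ)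
    basisOn-wf elementWF v τ eq with restrictTo-just Θ (prescribed m) v eq
    basisOn-wf elementWF (tv x) τ eq | v∈ , refl = wf-typed elementWF (λ _ _ ()) (matches v∈)
    basisOn-wf elementWF (sv x) τ eq | v∈ , refl = wf-typedˢ elementWF (λ _ _ ()) (matches v∈)
    basisOn-wf elementWF (ev x) τ eq | v∈ , refl = elementWF (eM m x)

  -- If direction: a solution m gives the basis basisOn m Θ and the type
  -- ⟨m(φ_X), m(ψ_X)⟩ witnessing applicability.
  solution⇒applicable : (∀ t → WF (⁅ t ⁆ , R t)) →
    ∀ {P₁ P₂ C σ X Θ Φ Ψ Ξ C₀ Φ' Ψ' Ξ' τ₁ P} → P₂ ⊳ (Θ , Φ , Ψ , Ξ) →
    IsCore C C₀ → fillₚ C₀ (tvar X) ⊳ ([ tv X ] , Φ' , Ψ' , Ξ') → C ⊢ᶜ τ₁ ⇒ (P , ⊥) →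
    (Σ TyMap λ m → Matches m σ Θ ×
      m ⊨* (Ξ ++ Ξ' ++ ((Φ ≐ pv (tv X)) ∷ (Ψ ≐ rv (tv X)) ∷ [])) × (OccX X Ψ' → m ⊨ (Ψ' ≐ lit ⊥))) →
    Applicable P₁ P₂ C σ
  solution⇒applicable elementWF {P₂ = P₂} {C} {σ} {X} {Θ} {Ξ = Ξ} {C₀} {Ξ' = Ξ'}
                      inferP₂ core inferC dC (m , matches , sat , occ)
    with sat-++³⁻ Ξ Ξ' _ sat
  ... | satΞ , satΞ' , (Φ≡ ∷ Ψ≡ ∷ []) =
    basisOn m Θ , tyAt m (tv X) , basisOn-agrees m σ Θ matches , dP₂ ,
    wf-typed elementWF (basisOn-wf m σ Θ matches elementWF) dP₂ ,
    proj₁ contextTyped , hole⁺ 0 (tyAt m (tv X)) C (proj₂ contextTyped)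
    where
    dP₂ : basisOn m Θ ⊢ P₂ ∶ tyAt m (tv X)
    dP₂ = subst (basisOn m Θ ⊢ P₂ ∶_) (cong₂ _,_ Φ≡ Ψ≡)
                (inferSound inferP₂ (basisOn-represents m σ Θ matches) satΞ)
    contextTyped = coreSufficient X m C C₀ core inferC dC satΞ' occ

mainTheorem6 : ∀ {n : ℕ} {E : Set} (Γ : E → Fin n) (R Ex : Fin n → Subset n) →
    (∀ t → t ∉ R t) → (∀ t → t ∉ Ex t) → (∀ t → R t ∩ Ex t ≡ ⊥) →
    let open CLS Γ R Ex in
    (P₁ P₂ : Pat) → RewriteRule P₁ P₂ →
    (C : Ctx) (σ : Inst) (X : ℕ) →
    (Θ : List Var) (Φ Ψ : SExp) (Ξ : List Constraint) →
    P₂ ⊳ (Θ , Φ , Ψ , Ξ) →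
    tv X ∉ₗ Θ →
    (C₀ : Ctx) → IsCore C C₀ →
    (Φ' Ψ' : SExp) (Ξ' : List Constraint) →
    fillₚ C₀ (tvar X) ⊳ ([ tv X ] , Φ' , Ψ' , Ξ') →
    (∃ λ P → ⊢₀ fill C (inst σ P₁) ∶ (P , ⊥)) →
    Applicable P₁ P₂ C σ ⇔
      (Σ TyMap λ m → Matches m σ Θ ×
         m ⊨* (Ξ ++ Ξ' ++ ((Φ ≐ pv (tv X)) ∷ (Ψ ≐ rv (tv X)) ∷ [])) ×
         (OccX X Ψ' → m ⊨ (Ψ' ≐ lit ⊥)))
mainTheorem6 Γ R Ex R-irrefl Ex-irrefl R∩Ex≡⊥ P₁ P₂ _ C σ X Θ Φ Ψ Ξ inferP₂ X∉Θ C₀ core Φ' Ψ' Ξ' inferC (P , dCP₁σ) =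
  mk⇔ (applicable⇒solution {P₁ = P₁} inferP₂ X∉Θ core inferC)
      (solution⇒applicable (elementTypesWF R-irrefl Ex-irrefl R∩Ex≡⊥) {P₁ = P₁} inferP₂ core inferC
                           (proj₂ (contextTyping C dCP₁σ)))
  where open Theory Γ R Ex
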